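{- Let $l\geq2$ and let $H$ be a $(2l+2)$-modest hypergraph. If two red vertices of $H$ are adjacent, then they belong to the same red block.
   Context: A hypergraph is a pair $H=(U,T)$ with $U$ a finite nonempty vertex set and $T$ a collection of 3-element subsets of $U$ (hyperedges). For nonempty $X\subseteq U$, $\|X\|$ is its cardinality and $[X]$ is the number of hyperedges contained in $X$. $X$ is dense if $\|X\|\le2[X]$, super-dense if $\|X\|<2[X]$; a minimal dense set is a dense set with no proper nonempty dense subset. $H$ is $m$-modest if it has no super-dense vertex sets of cardinality $\le 2m$. Vertices $x,y$ are adjacent if some hyperedge contains both. With respect to the fixed $l$: a red block is a minimal dense vertex set of cardinality $\le2l$; a vertex is red if it belongs to a red block, and green otherwise. -}

module Defs where

open import Data.Nat using (ℕ; _≤_; _<_; _*_)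
open import Data.Fin using (Fin)
open import Data.Fin.Subset using (Subset; _∈_; _⊂_; ∣_∣; Nonempty)
open import Data.Fin.Subset.Properties using (_⊆?_)
open import Data.List using (List; length; filter)
open import Data.List.Relation.Unary.All using (All)
open import Data.List.Relation.Unary.Any using (Any)
open import Data.List.Relation.Unary.Unique.Propositional using (Unique)
open import Data.Product using (Σ; ∃; _×_)
open import Relation.Binary.PropositionalEquality using (_≡_)
open import Relation.Nullary using (¬_)

-- A 3-uniform hypergraph on the vertex set U = Fin n.
-- T is a finite set (duplicate-free list) of 3-element subsets of U.
record Hypergraph (n : ℕ) : Set where
  field
    edges       : List (Subset n)
    edges-3     : All (λ e → ∣ e ∣ ≡ 3) edges
    edges-uniq  : Unique edges
open Hypergraph public

module _ {n : ℕ} (H : Hypergraph n) where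

  -- [X] : number of hyperedges contained in X
  edgesIn : Subset n → ℕ
  edgesIn X = length (filter (λ e → e ⊆? X) (edges H))

  Dense : Subset n → Set
  Dense X = Nonempty X × ∣ X ∣ ≤ 2 * edgesIn X

  SuperDense : Subset n → Set
  SuperDense X = Nonempty X × ∣ X ∣ < 2 * edgesIn X

  MinimalDense : Subset n → Set
  MinimalDense X = Dense X × (∀ Y → Y ⊂ X → ¬ Dense Y)

  Modest : ℕ → Set
  Modest m = ∀ X → ∣ X ∣ ≤ 2 * m → ¬ SuperDense X

  Adjacent : Fin n → Fin n → Set
  Adjacent x y = Any (λ e → x ∈ e × y ∈ e) (edges H)

  RedBlock : ℕ → Subset n → Set
  RedBlock l B = MinimalDense B × ∣ B ∣ ≤ 2 * l

  Red : ℕ → Fin n → Set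
  Red l x = ∃ λ B → RedBlock l B × x ∈ B

-- Let A ∋ x and B ∋ y be red blocks with y ∉ A. If A and B meet, then A ∩ B is a
-- nonempty proper subset of the minimal dense set B, hence not dense, and
-- supermodularity of X ↦ [X] makes A ∪ B super-dense. If they are disjoint, an edge
-- e through x and y adds at most one vertex to A ∪ B but at least one edge that lies
-- in neither block, so A ∪ B ∪ e is super-dense. Both sets have at most 4l + 1
-- vertices, contradicting (2l + 2)-modesty.
module Submission where

open import Defs

open import Data.Empty using (⊥-elim)
open import Data.Fin using (Fin)
open import Data.Fin.Subset
open import Data.Fin.Subset.Properties
open import Data.List using (List; []; _∷_; length; filter)
open import Data.List.Membership.Propositional using (find; lose) renaming (_∈_ to _∈ₗ_)
open import Data.List.Properties using (filter-none)
open import Data.List.Relation.Unary.All as All using (All)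
open import Data.List.Relation.Unary.Any as Any using (Any; here; there)
open import Data.Nat using (ℕ; suc; _≤_; _<_; _+_; _*_; z≤n; s≤s)
open import Data.Nat.Properties
open import Algebra.Properties.CommutativeSemigroup +-commutativeSemigroup using (interchange)
open import Data.Nat.Tactic.RingSolver using (solve-∀)
open import Data.Product using (∃; _×_; _,_)
open import Data.Vec using ([]; _∷_)
open import Level using (Level)
open import Relation.Binary.PropositionalEquality
open import Relation.Nullary using (Dec; yes; no; ¬_; contradiction)
open import Relation.Unary using (Pred; Decidable)

∣p∪q∣+∣p∩q∣≡∣p∣+∣q∣ : ∀ {n} (p q : Subset n) → ∣ p ∪ q ∣ + ∣ p ∩ q ∣ ≡ ∣ p ∣ + ∣ q ∣
∣p∪q∣+∣p∩q∣≡∣p∣+∣q∣ []            []            = refl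
∣p∪q∣+∣p∩q∣≡∣p∣+∣q∣ (inside  ∷ p) (inside  ∷ q) =
  cong suc (trans (+-suc _ _) (trans (cong suc (∣p∪q∣+∣p∩q∣≡∣p∣+∣q∣ p q)) (sym (+-suc _ _))))
∣p∪q∣+∣p∩q∣≡∣p∣+∣q∣ (inside  ∷ p) (outside ∷ q) = cong suc (∣p∪q∣+∣p∩q∣≡∣p∣+∣q∣ p q)
∣p∪q∣+∣p∩q∣≡∣p∣+∣q∣ (outside ∷ p) (inside  ∷ q) =
  trans (cong suc (∣p∪q∣+∣p∩q∣≡∣p∣+∣q∣ p q)) (sym (+-suc _ _))
∣p∪q∣+∣p∩q∣≡∣p∣+∣q∣ (outside ∷ p) (outside ∷ q) = ∣p∪q∣+∣p∩q∣≡∣p∣+∣q∣ p q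

∣p∪q∣≤∣p∣+∣q∣ : ∀ {n} (p q : Subset n) → ∣ p ∪ q ∣ ≤ ∣ p ∣ + ∣ q ∣
∣p∪q∣≤∣p∣+∣q∣ p q = ≤-trans (m≤m+n _ _) (≤-reflexive (∣p∪q∣+∣p∩q∣≡∣p∣+∣q∣ p q))

x∈p∧y∈p∧x≢y⇒2≤∣p∣ : ∀ {n} {x y : Fin n} {p : Subset n} → x ∈ p → y ∈ p → x ≢ y → 2 ≤ ∣ p ∣
x∈p∧y∈p∧x≢y⇒2≤∣p∣ x∈p y∈p x≢y =
  ≤-trans (s≤s (≤-trans (s≤s z≤n) (x∈p⇒∣p-x∣<∣p∣ (x∈p∧x≢y⇒x∈p-y x∈p x≢y))))
          (x∈p⇒∣p-x∣<∣p∣ y∈p)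

∣p∪q∣≤∣p∣+1 : ∀ {n} {x y : Fin n} {p q : Subset n} → ∣ q ∣ ≡ 3 →
              x ∈ p ∩ q → y ∈ p ∩ q → x ≢ y → ∣ p ∪ q ∣ ≤ ∣ p ∣ + 1
∣p∪q∣≤∣p∣+1 {p = p} {q} ∣q∣≡3 x∈p∩q y∈p∩q x≢y = +-cancelʳ-≤ 2 _ _ (begin
  ∣ p ∪ q ∣ + 2         ≤⟨ +-monoʳ-≤ ∣ p ∪ q ∣ (x∈p∧y∈p∧x≢y⇒2≤∣p∣ x∈p∩q y∈p∩q x≢y) ⟩
  ∣ p ∪ q ∣ + ∣ p ∩ q ∣ ≡⟨ ∣p∪q∣+∣p∩q∣≡∣p∣+∣q∣ p q ⟩
  ∣ p ∣ + ∣ q ∣         ≡⟨ cong (∣ p ∣ +_) ∣q∣≡3 ⟩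
  ∣ p ∣ + 3             ≡⟨ +-assoc ∣ p ∣ 1 2 ⟨
  ∣ p ∣ + 1 + 2         ∎)
  where open ≤-Reasoning

module _ {ℓ : Level} where

  indicator : {P : Set ℓ} → Dec P → ℕ
  indicator (yes _) = 1
  indicator (no  _) = 0

  indicator-yes : {P : Set ℓ} (P? : Dec P) → P → indicator P? ≡ 1
  indicator-yes (yes _) _  = refl
  indicator-yes (no ¬p) p  = contradiction p ¬p

  indicator-no : {P : Set ℓ} (P? : Dec P) → ¬ P → indicator P? ≡ 0
  indicator-no (yes p) ¬p = contradiction p ¬p
  indicator-no (no _)  _  = refl

module _ {a ℓ : Level} {A : Set a} where

  count : {P : Pred A ℓ} → Decidable P → List A → ℕ
  count P? xs = length (filter P? xs)

  count-∷ : {P : Pred A ℓ} (P? : Decidable P) (x : A) (xs : List A) →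
            count P? (x ∷ xs) ≡ indicator (P? x) + count P? xs
  count-∷ P? x xs with P? x
  ... | yes _ = refl
  ... | no  _ = refl

  module _ {P Q R S : Pred A ℓ} (P? : Decidable P) (Q? : Decidable Q)
           (R? : Decidable R) (S? : Decidable S) where

    private
      count+count-∷ : {U V : Pred A ℓ} (U? : Decidable U) (V? : Decidable V) (x : A) (xs : List A) →
                      count U? (x ∷ xs) + count V? (x ∷ xs) ≡
                      (indicator (U? x) + indicator (V? x)) + (count U? xs + count V? xs)
      count+count-∷ U? V? x xs =
        trans (cong₂ _+_ (count-∷ U? x xs) (count-∷ V? x xs)) (interchange (indicator (U? x)) (count U? xs) (indicator (V? x)) (count V? xs))

    count+count≤count+count :
      (∀ x → indicator (P? x) + indicator (Q? x) ≤ indicator (R? x) + indicator (S? x)) →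
      ∀ xs → count P? xs + count Q? xs ≤ count R? xs + count S? xs
    count+count≤count+count pointwise []       = z≤n
    count+count≤count+count pointwise (x ∷ xs) =
      subst₂ _≤_ (sym (count+count-∷ P? Q? x xs)) (sym (count+count-∷ R? S? x xs))
        (+-mono-≤ (pointwise x) (count+count≤count+count pointwise xs))

    count+count<count+count :
      (∀ x → indicator (P? x) + indicator (Q? x) ≤ indicator (R? x) + indicator (S? x)) →
      ∀ {xs} → Any (λ x → indicator (P? x) + indicator (Q? x) < indicator (R? x) + indicator (S? x)) xs →
      count P? xs + count Q? xs < count R? xs + count S? xs
    count+count<count+count pointwise {x ∷ xs} (here strict) =
      subst₂ _<_ (sym (count+count-∷ P? Q? x xs)) (sym (count+count-∷ R? S? x xs))
        (+-mono-<-≤ strict (count+count≤count+count pointwise xs))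
    count+count<count+count pointwise {x ∷ xs} (there strict) =
      subst₂ _<_ (sym (count+count-∷ P? Q? x xs)) (sym (count+count-∷ R? S? x xs))
        (+-mono-≤-< (pointwise x) (count+count<count+count pointwise strict))

module _ {n : ℕ} {A B C : Subset n} (A⊆C : A ⊆ C) (B⊆C : B ⊆ C) where

  ⊆-indicator-supermodular : ∀ f →
    indicator (f ⊆? A) + indicator (f ⊆? B) ≤ indicator (f ⊆? C) + indicator (f ⊆? A ∩ B)
  ⊆-indicator-supermodular f with f ⊆? A | f ⊆? B
  ... | yes f⊆A | yes f⊆B = ≤-reflexive (sym (cong₂ _+_
          (indicator-yes (f ⊆? C) (⊆-trans f⊆A A⊆C))
          (indicator-yes (f ⊆? A ∩ B) (λ z∈f → x∈p∩q⁺ (f⊆A z∈f , f⊆B z∈f)))))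
  ... | yes f⊆A | no _    = ≤-trans (≤-reflexive (sym (indicator-yes (f ⊆? C) (⊆-trans f⊆A A⊆C))))
                                    (m≤m+n _ _)
  ... | no _    | yes f⊆B = ≤-trans (≤-reflexive (sym (indicator-yes (f ⊆? C) (⊆-trans f⊆B B⊆C))))
                                    (m≤m+n _ _)
  ... | no _    | no _    = z≤n

  ⊆-indicator-supermodular-strict : ∀ {f} → f ⊆ C → ¬ f ⊆ A → ¬ f ⊆ B →
    indicator (f ⊆? A) + indicator (f ⊆? B) < indicator (f ⊆? C) + indicator (f ⊆? A ∩ B)
  ⊆-indicator-supermodular-strict {f} f⊆C f⊈A f⊈B = begin-strict
    indicator (f ⊆? A) + indicator (f ⊆? B)
      ≡⟨ cong₂ _+_ (indicator-no (f ⊆? A) f⊈A) (indicator-no (f ⊆? B) f⊈B) ⟩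
    0 <⟨ s≤s z≤n ⟩
    1 ≡⟨ indicator-yes (f ⊆? C) f⊆C ⟨
    indicator (f ⊆? C) ≤⟨ m≤m+n _ _ ⟩
    indicator (f ⊆? C) + indicator (f ⊆? A ∩ B) ∎
    where open ≤-Reasoning

module _ {n : ℕ} (H : Hypergraph n) where

  edgesIn-supermodular : {A B C : Subset n} → A ⊆ C → B ⊆ C →
    edgesIn H A + edgesIn H B ≤ edgesIn H C + edgesIn H (A ∩ B)
  edgesIn-supermodular {A} {B} {C} A⊆C B⊆C =
    count+count≤count+count (_⊆? A) (_⊆? B) (_⊆? C) (_⊆? A ∩ B)
      (⊆-indicator-supermodular A⊆C B⊆C) (edges H)

  edgesIn-supermodular-strict : {A B C : Subset n} → A ⊆ C → B ⊆ C →
    Any (λ e → e ⊆ C × ¬ e ⊆ A × ¬ e ⊆ B) (edges H) →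
    edgesIn H A + edgesIn H B < edgesIn H C + edgesIn H (A ∩ B)
  edgesIn-supermodular-strict {A} {B} {C} A⊆C B⊆C witness =
    count+count<count+count (_⊆? A) (_⊆? B) (_⊆? C) (_⊆? A ∩ B)
      (⊆-indicator-supermodular A⊆C B⊆C)
      (Any.map (λ (e⊆C , e⊈A , e⊈B) → ⊆-indicator-supermodular-strict A⊆C B⊆C e⊆C e⊈A e⊈B) witness)

  edgesIn-Empty : {X : Subset n} → Empty X → edgesIn H X ≡ 0
  edgesIn-Empty {X} X-empty = cong length (filter-none (_⊆? X) (All.map edge⊈X (edges-3 H)))
    where
    edge⊈X : ∀ {e} → ∣ e ∣ ≡ 3 → ¬ e ⊆ X
    edge⊈X {e} ∣e∣≡3 e⊆X with () ← ≤-trans (≤-reflexive (sym ∣e∣≡3))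
      (≤-trans (p⊆q⇒∣p∣≤∣q∣ e⊆X) (≤-reflexive (trans (cong ∣_∣ (Empty-unique X-empty)) (∣⊥∣≡0 n))))

  minimalDense⇒⊂-sparse : {B Y : Subset n} → MinimalDense H B → Y ⊂ B → Nonempty Y →
    2 * edgesIn H Y < ∣ Y ∣
  minimalDense⇒⊂-sparse (_ , minimal) Y⊂B Y≢∅ = ≰⇒> (λ dense → minimal _ Y⊂B (Y≢∅ , dense))

  superDense-∪ : {A B : Subset n} → Dense H A → Dense H B → Nonempty (A ∩ B) →
    2 * edgesIn H (A ∩ B) < ∣ A ∩ B ∣ → SuperDense H (A ∪ B)
  superDense-∪ {A} {B} ((x , x∈A) , ∣A∣≤) (_ , ∣B∣≤) _ sparse =
    (x , p⊆p∪q B x∈A) , +-cancelʳ-< ∣ A ∩ B ∣ _ _ (begin-strict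
      ∣ A ∪ B ∣ + ∣ A ∩ B ∣                   ≡⟨ ∣p∪q∣+∣p∩q∣≡∣p∣+∣q∣ A B ⟩
      ∣ A ∣ + ∣ B ∣                           ≤⟨ +-mono-≤ ∣A∣≤ ∣B∣≤ ⟩
      2 * edgesIn H A + 2 * edgesIn H B       ≡⟨ *-distribˡ-+ 2 (edgesIn H A) _ ⟨
      2 * (edgesIn H A + edgesIn H B)         ≤⟨ *-monoʳ-≤ 2 (edgesIn-supermodular (p⊆p∪q B) (q⊆p∪q A B)) ⟩
      2 * (edgesIn H (A ∪ B) + edgesIn H (A ∩ B)) ≡⟨ *-distribˡ-+ 2 (edgesIn H (A ∪ B)) _ ⟩
      2 * edgesIn H (A ∪ B) + 2 * edgesIn H (A ∩ B) <⟨ +-monoʳ-< (2 * edgesIn H (A ∪ B)) sparse ⟩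
      2 * edgesIn H (A ∪ B) + ∣ A ∩ B ∣       ∎)
    where open ≤-Reasoning

  module _ {A B e : Subset n} {x y : Fin n} (A∩B-empty : Empty (A ∩ B))
           (x∈A : x ∈ A) (y∈B : y ∈ B) (e∈H : e ∈ₗ edges H) (x∈e : x ∈ e) (y∈e : y ∈ e) where

    private
      x∉B : x ∉ B
      x∉B x∈B = A∩B-empty (x , x∈p∩q⁺ (x∈A , x∈B))

      y∉A : y ∉ A
      y∉A y∈A = A∩B-empty (y , x∈p∩q⁺ (y∈A , y∈B))

    ∣A∪B∪e∣≤∣A∣+∣B∣+1 : ∣ (A ∪ B) ∪ e ∣ ≤ ∣ A ∣ + ∣ B ∣ + 1
    ∣A∪B∪e∣≤∣A∣+∣B∣+1 =
      ≤-trans (∣p∪q∣≤∣p∣+1 (All.lookup (edges-3 H) e∈H)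
                (x∈p∩q⁺ (p⊆p∪q B x∈A , x∈e)) (x∈p∩q⁺ (q⊆p∪q A B y∈B , y∈e))
                (λ { refl → x∉B y∈B }))
              (+-monoˡ-≤ 1 (∣p∪q∣≤∣p∣+∣q∣ A B))

    superDense-∪-edge : Dense H A → Dense H B → SuperDense H ((A ∪ B) ∪ e)
    superDense-∪-edge (_ , ∣A∣≤) (_ , ∣B∣≤) = (x , p⊆p∪q e (p⊆p∪q B x∈A)) , (begin-strict
      ∣ (A ∪ B) ∪ e ∣                        ≤⟨ ∣A∪B∪e∣≤∣A∣+∣B∣+1 ⟩
      ∣ A ∣ + ∣ B ∣ + 1                      ≤⟨ +-monoˡ-≤ 1 (+-mono-≤ ∣A∣≤ ∣B∣≤) ⟩
      2 * edgesIn H A + 2 * edgesIn H B + 1  <⟨ +-monoʳ-< _ (s≤s (s≤s z≤n)) ⟩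
      2 * edgesIn H A + 2 * edgesIn H B + 2  ≡⟨ cong (_+ 2) (*-distribˡ-+ 2 (edgesIn H A) _) ⟨
      2 * (edgesIn H A + edgesIn H B) + 2    ≡⟨ +-comm _ 2 ⟩
      2 + 2 * (edgesIn H A + edgesIn H B)    ≡⟨ *-suc 2 _ ⟨
      2 * suc (edgesIn H A + edgesIn H B)    ≤⟨ *-monoʳ-≤ 2 more-edges ⟩
      2 * edgesIn H ((A ∪ B) ∪ e)            ∎)
      where
      open ≤-Reasoning
      more-edges : suc (edgesIn H A + edgesIn H B) ≤ edgesIn H ((A ∪ B) ∪ e)
      more-edges = ≤-trans
        (edgesIn-supermodular-strict (⊆-trans (p⊆p∪q B) (p⊆p∪q e)) (⊆-trans (q⊆p∪q A B) (p⊆p∪q e))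
          (lose e∈H (q⊆p∪q (A ∪ B) e , (λ e⊆A → y∉A (e⊆A y∈e)) , (λ e⊆B → x∉B (e⊆B x∈e)))))
        (≤-reflexive (trans (cong (edgesIn H ((A ∪ B) ∪ e) +_) (edgesIn-Empty A∩B-empty))
                            (+-identityʳ _)))

two-blocks-bound : ∀ {a b} l → a ≤ 2 * l → b ≤ 2 * l → a + b + 1 ≤ 2 * (2 * l + 2)
two-blocks-bound l a≤ b≤ =
  ≤-trans (+-monoˡ-≤ 1 (+-mono-≤ a≤ b≤)) (≤-trans (m≤m+n _ 3) (≤-reflexive (4l+4≡ l)))
  where
  4l+4≡ : ∀ l → 2 * l + 2 * l + 1 + 3 ≡ 2 * (2 * l + 2)
  4l+4≡ = solve-∀

lemma2p3p2 : (l : ℕ) → 2 ≤ l → {n : ℕ} (H : Hypergraph n) → Modest H (2 * l + 2) →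
    (x y : Fin n) → Red H l x → Red H l y → Adjacent H x y →
    ∃ λ B → RedBlock H l B × x ∈ B × y ∈ B
lemma2p3p2 l _ H modest x y (A , redA@((denseA , _) , ∣A∣≤) , x∈A) (B , ((denseB , minB) , ∣B∣≤) , y∈B) adj
  with y ∈? A
... | yes y∈A = A , redA , x∈A , y∈A
... | no  y∉A with nonempty? (A ∩ B)
...   | yes A∩B≢∅ = ⊥-elim (modest (A ∪ B)
          (≤-trans (∣p∪q∣≤∣p∣+∣q∣ A B) (≤-trans (m≤m+n _ 1) (two-blocks-bound l ∣A∣≤ ∣B∣≤)))
          (superDense-∪ H denseA denseB A∩B≢∅
            (minimalDense⇒⊂-sparse H (denseB , minB) A∩B⊂B A∩B≢∅)))
  where
  A∩B⊂B : A ∩ B ⊂ B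
  A∩B⊂B = p∩q⊆q A B , y , y∈B , (λ y∈A∩B → y∉A (p∩q⊆p A B y∈A∩B))
...   | no  A∩B-empty with find adj
...     | e , e∈H , x∈e , y∈e = ⊥-elim (modest ((A ∪ B) ∪ e)
          (≤-trans (∣A∪B∪e∣≤∣A∣+∣B∣+1 H A∩B-empty x∈A y∈B e∈H x∈e y∈e) (two-blocks-bound l ∣A∣≤ ∣B∣≤))
          (superDense-∪-edge H A∩B-empty x∈A y∈B e∈H x∈e y∈e denseA denseB))
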